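{- Let $G=(V_G,E_G)$ be a graph and let $D_{ev}$ be a minimum edge-vertex dominating set of $G$. If there exist two edges in $D_{ev}$ sharing a vertex, then there exist two distinct minimum edge-vertex dominating sets $D'_{ev}$ and $D''_{ev}$ of $G$ such that $V_G(D'_{ev})\neq V_G(D''_{ev})$ and no two edges in $D'_{ev}$ share a vertex, and no two edges in $D''_{ev}$ share a vertex.
   Context: All graphs are finite and simple. For $M\subseteq E_G$, $V_G(M)$ denotes the set of vertices incident to edges of $M$. An edge $e$ ev-dominates a vertex $v$ if $e$ is incident to $v$ or $e$ is incident to a vertex adjacent to $v$. A set $M\subseteq E_G$ is an edge-vertex dominating set of $G$ if every vertex of $G$ is ev-dominated by some edge of $M$; it is minimum if it has minimum cardinality among all edge-vertex dominating sets of $G$. -}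

module Defs where

open import Data.Nat using (ℕ; _≤_)
open import Data.Fin using (Fin; _<_)
open import Data.Product using (Σ; ∃; _×_; _,_; proj₁; proj₂)
open import Data.Sum using (_⊎_)
open import Data.List using (List; length)
open import Data.List.Relation.Unary.All using (All)
open import Data.List.Relation.Unary.Any using (Any)
open import Data.List.Relation.Unary.Unique.Propositional using (Unique)
open import Data.List.Membership.Propositional using (_∈_)
open import Relation.Binary.PropositionalEquality using (_≡_; _≢_)
open import Relation.Nullary using (¬_)
open import Function.Bundles using (_⇔_)

record Graph : Set₁ where
  field
    n       : ℕ
    Adj     : Fin n → Fin n → Set
    sym     : ∀ {u v} → Adj u v → Adj v u
    irrefl  : ∀ {u} → ¬ Adj u u
open Graph public

-- An edge {u,v} is represented canonically by the pair (u , v) with u < v.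
Pair : Graph → Set
Pair G = Fin (n G) × Fin (n G)

IsEdge : (G : Graph) → Pair G → Set
IsEdge G (u , v) = (u < v) × Adj G u v

-- A set of edges: a duplicate-free list of edges of G (cardinality = length).
IsEdgeSet : (G : Graph) → List (Pair G) → Set
IsEdgeSet G M = All (IsEdge G) M × Unique M

Incident : (G : Graph) → Pair G → Fin (n G) → Set
Incident G (a , b) v = (v ≡ a) ⊎ (v ≡ b)

EVDominates : (G : Graph) → Pair G → Fin (n G) → Set
EVDominates G e v = Incident G e v ⊎ ∃ λ w → Incident G e w × Adj G w v

IsEVDS : (G : Graph) → List (Pair G) → Set
IsEVDS G M = IsEdgeSet G M × (∀ v → Any (λ e → EVDominates G e v) M)

IsMinEVDS : (G : Graph) → List (Pair G) → Set
IsMinEVDS G M = IsEVDS G M × (∀ M' → IsEVDS G M' → length M ≤ length M')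

ShareVertex : (G : Graph) → Pair G → Pair G → Set
ShareVertex G e f = ∃ λ v → Incident G e v × Incident G f v

HasAdjacentEdges : (G : Graph) → List (Pair G) → Set
HasAdjacentEdges G M = ∃ λ e → ∃ λ f → e ∈ M × f ∈ M × e ≢ f × ShareVertex G e f

NoTwoShare : (G : Graph) → List (Pair G) → Set
NoTwoShare G M = ∀ e f → e ∈ M → f ∈ M → e ≢ f → ¬ ShareVertex G e f

InVG : (G : Graph) → List (Pair G) → Fin (n G) → Set
InVG G M v = Any (λ e → Incident G e v) M

SameEdgeSet : (G : Graph) → List (Pair G) → List (Pair G) → Set
SameEdgeSet G M M' = ∀ e → (e ∈ M) ⇔ (e ∈ M')

SameVertexSet : (G : Graph) → List (Pair G) → List (Pair G) → Set
SameVertexSet G M M' = ∀ v → InVG G M v ⇔ InVG G M' v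

-- Fix, for every vertex z, a vertex anchor z of V(D) in the closed neighbourhood
-- of z. By minimality of D no edge of D has both endpoints shared with other edges
-- of D, and if the endpoint c of an edge cl of D is shared, then l has a private
-- neighbour p: a vertex outside V(D) anchored at l. Choose for every shared vertex
-- one edge of D through it as its owner, and replace every edge cl whose shared
-- endpoint c it does not own by lp. The result is a matching of the same size that
-- still covers V(D), hence a minimum edge-vertex dominating set. If v is shared by
-- two edges e₁ and e₂ of D, letting e₁ resp. e₂ own v gives two such matchings:
-- the private neighbour that replaces e₂ in the first is not covered by the second.
module Submission where

open import Defs
open import Data.List using (List)
open import Data.Product using (∃; _×_)
open import Relation.Nullary using (¬_)

open import Function using (_∘_)
open import Function.Bundles using (Equivalence; mk⇔)
open import Data.Empty using (⊥; ⊥-elim)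
open import Data.Nat using (_≤_)
import Data.Nat.Properties as ℕ
open import Data.Fin as Fin using (Fin)
import Data.Fin.Properties as Fin
open import Data.Product using (∃₂; _,_; proj₁; proj₂)
import Data.Product.Properties as Product
open import Data.Sum using (_⊎_; inj₁; inj₂; swap)
open import Data.List using (map; filter; length)
open import Data.List.Properties using (length-map; filter-notAll)
open import Data.List.Relation.Unary.All as All using (All)
open import Data.List.Relation.Unary.Any as Any using (Any; any?)
import Data.List.Relation.Unary.All.Properties as All
open import Data.List.Relation.Unary.AllPairs using ([]; _∷_)
open import Data.List.Relation.Unary.Unique.Propositional using (Unique)
import Data.List.Relation.Unary.Unique.Propositional.Properties as Unique
open import Data.List.Membership.Propositional using (_∈_; find; lose)
open import Data.List.Membership.Propositional.Properties using (∈-map⁺; ∈-map⁻; ∈-filter⁺)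
open import Data.List.Relation.Binary.Subset.Propositional.Properties using (Any-resp-⊆)
open import Relation.Nullary using (Dec; yes; no; ¬?)
open import Relation.Nullary.Decidable using (_⊎-dec_; _×-dec_; decidable-stable)
open import Relation.Binary.Definitions using (DecidableEquality)
import Relation.Binary.PropositionalEquality as ≡
open ≡ using (_≡_; _≢_; refl; trans; subst)

unique-map⁺ : ∀ {A B : Set} (f : A → B) {xs : List A} →
              (∀ {x y} → x ∈ xs → y ∈ xs → x ≢ y → f x ≢ f y) →
              Unique xs → Unique (map f xs)
unique-map⁺ f f-inj [] = []
unique-map⁺ f f-inj (x∉xs ∷ xs!) =
  All.map⁺ (All.tabulate λ y∈ → f-inj (Any.here refl) (Any.there y∈) (All.lookup x∉xs y∈))
  ∷ unique-map⁺ f (λ x∈ y∈ → f-inj (Any.there x∈) (Any.there y∈)) xs!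

module GraphBasics (G : Graph) where

  Near : Fin (n G) → Fin (n G) → Set
  Near x z = x ≡ z ⊎ Adj G x z

  incident? : (e : Pair G) (x : Fin (n G)) → Dec (Incident G e x)
  incident? (a , b) x = (x Fin.≟ a) ⊎-dec (x Fin.≟ b)

  incident-other : ∀ {e : Pair G} {c l y} → Incident G e c → Incident G e l → c ≢ l →
                   Incident G e y → y ≡ c ⊎ y ≡ l
  incident-other (inj₁ refl) (inj₁ refl) c≢l _  = ⊥-elim (c≢l refl)
  incident-other (inj₁ refl) (inj₂ refl) _   iy = iy
  incident-other (inj₂ refl) (inj₁ refl) _   iy = swap iy
  incident-other (inj₂ refl) (inj₂ refl) c≢l _  = ⊥-elim (c≢l refl)

  isEdge⇒ends-≢ : ∀ {a b} → IsEdge G (a , b) → a ≢ b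
  isEdge⇒ends-≢ (a<b , _) = Fin.<⇒≢ a<b

  isEdge⇒adjacent : ∀ {e x y} → IsEdge G e → Incident G e x → Incident G e y → x ≢ y → Adj G x y
  isEdge⇒adjacent _        (inj₁ refl) (inj₁ refl) x≢y = ⊥-elim (x≢y refl)
  isEdge⇒adjacent (_ , ab) (inj₁ refl) (inj₂ refl) _   = ab
  isEdge⇒adjacent (_ , ab) (inj₂ refl) (inj₁ refl) _   = sym G ab
  isEdge⇒adjacent _        (inj₂ refl) (inj₂ refl) x≢y = ⊥-elim (x≢y refl)

  evDominates⇒near : ∀ {e z} → EVDominates G e z → ∃ λ x → Incident G e x × Near x z
  evDominates⇒near (inj₁ iz)           = _ , iz , inj₁ refl
  evDominates⇒near (inj₂ (x , ix , a)) = x , ix , inj₂ a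

  near⇒evDominates : ∀ {e x z} → Incident G e x → Near x z → EVDominates G e z
  near⇒evDominates ix (inj₁ refl) = inj₁ ix
  near⇒evDominates ix (inj₂ a)    = inj₂ (_ , ix , a)

  near-covered⇒dominated : ∀ {M x z} → InVG G M x → Near x z →
                           Any (λ e → EVDominates G e z) M
  near-covered⇒dominated cx xz = Any.map (λ ix → near⇒evDominates ix xz) cx

  disjoint⇒≢ : ∀ {e f} → ¬ ShareVertex G e f → e ≢ f
  disjoint⇒≢ {a , b} e∩f=∅ refl = e∩f=∅ (a , inj₁ refl , inj₁ refl)

  sameEdgeSet⇒sameVertexSet : ∀ {M M'} → SameEdgeSet G M M' → SameVertexSet G M M'
  sameEdgeSet⇒sameVertexSet M=M' v =
    mk⇔ (Any-resp-⊆ (Equivalence.to (M=M' _))) (Any-resp-⊆ (Equivalence.from (M=M' _)))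

  orient : Fin (n G) → Fin (n G) → Pair G
  orient x y with x Fin.<? y
  ... | yes _ = x , y
  ... | no  _ = y , x

  orient-isEdge : ∀ {x y} → x ≢ y → Adj G x y → IsEdge G (orient x y)
  orient-isEdge {x} {y} x≢y xy with x Fin.<? y
  ... | yes x<y = x<y , xy
  ... | no  x≮y = Fin.≤∧≢⇒< (ℕ.≮⇒≥ x≮y) (x≢y ∘ ≡.sym) , sym G xy

  orient-incident : ∀ x y {z} → Incident G (orient x y) z → z ≡ x ⊎ z ≡ y
  orient-incident x y iz with x Fin.<? y
  ... | yes _ = iz
  ... | no  _ = swap iz

  orient-incidentˡ : ∀ x y → Incident G (orient x y) x
  orient-incidentˡ x y with x Fin.<? y
  ... | yes _ = inj₁ refl
  ... | no  _ = inj₂ refl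

  orient-incidentʳ : ∀ x y → Incident G (orient x y) y
  orient-incidentʳ x y with x Fin.<? y
  ... | yes _ = inj₂ refl
  ... | no  _ = inj₁ refl

module Minimum (G : Graph) (D : List (Pair G)) (D-min : IsMinEVDS G D) where

  open GraphBasics G public

  private
    V = Fin (n G)
    P = Pair G

  D-edges : All (IsEdge G) D
  D-edges = proj₁ (proj₁ (proj₁ D-min))

  D-unique : Unique D
  D-unique = proj₂ (proj₁ (proj₁ D-min))

  D-ends-≢ : ∀ {a b} → (a , b) ∈ D → a ≢ b
  D-ends-≢ e∈ = isEdge⇒ends-≢ (All.lookup D-edges e∈)

  _≟ₚ_ : DecidableEquality P
  _≟ₚ_ = Product.≡-dec Fin._≟_ Fin._≟_

  Covered : V → Set
  Covered = InVG G D

  covered? : ∀ x → Dec (Covered x)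
  covered? x = any? (λ e → incident? e x) D

  -- A fixed choice function: it makes the private neighbours of distinct vertices distinct.
  anchored : ∀ z → ∃ λ x → Covered x × Near x z
  anchored z with find (proj₂ (proj₁ D-min) z)
  ... | e , e∈ , ev with evDominates⇒near ev
  ... | x , ix , xz = x , lose e∈ ix , xz

  anchor : V → V
  anchor z = proj₁ (anchored z)

  anchor-covered : ∀ z → Covered (anchor z)
  anchor-covered z = proj₁ (proj₂ (anchored z))

  anchor-near : ∀ z → Near (anchor z) z
  anchor-near z = proj₂ (proj₂ (anchored z))

  Private : V → V → Set
  Private l p = ¬ Covered p × anchor p ≡ l

  private? : ∀ l → Dec (∃ (Private l))
  private? l = Fin.any? λ p → ¬? (covered? p) ×-dec (anchor p Fin.≟ l)

  private-adjacent : ∀ {l p} → Private l p → Adj G l p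
  private-adjacent {p = p} (p∉ , refl) with anchor-near p
  ... | inj₁ anchor≡p = ⊥-elim (p∉ (subst Covered anchor≡p (anchor-covered p)))
  ... | inj₂ adj      = adj

  covered-private-≢ : ∀ {l p} → Covered l → Private l p → l ≢ p
  covered-private-≢ cl (p∉ , _) refl = p∉ cl

  others : P → List P
  others e = filter (λ g → ¬? (g ≟ₚ e)) D

  Shared : P → V → Set
  Shared e = InVG G (others e)

  shared? : ∀ e x → Dec (Shared e x)
  shared? e x = any? (λ g → incident? g x) (others e)

  shared-by : ∀ {d e x} → d ∈ D → d ≢ e → Incident G d x → Shared e x
  shared-by {e = e} d∈ d≢e = lose (∈-filter⁺ (λ g → ¬? (g ≟ₚ e)) d∈ d≢e)

  covered⇒shared⊎incident : ∀ {e x} → Covered x → Shared e x ⊎ Incident G e x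
  covered⇒shared⊎incident {e} cx with find cx
  ... | d , d∈ , ix with d ≟ₚ e
  ...   | yes refl = inj₂ ix
  ...   | no  d≢e  = inj₁ (shared-by d∈ d≢e ix)

  OthersDominate : P → Set
  OthersDominate e = ∀ z → ∃ λ x → Shared e x × Near x z

  ¬othersDominate : ∀ {e} → e ∈ D → ¬ OthersDominate e
  ¬othersDominate {e} e∈ dom =
    ℕ.<⇒≱ (filter-notAll (λ g → ¬? (g ≟ₚ e)) D (lose e∈ λ e≢e → e≢e refl))
          (proj₂ D-min (others e) (others-edgeSet , others-dominating))
    where
    others-edgeSet : IsEdgeSet G (others e)
    others-edgeSet = All.filter⁺ (λ g → ¬? (g ≟ₚ e)) D-edges , Unique.filter⁺ (λ g → ¬? (g ≟ₚ e)) D-unique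
    others-dominating : ∀ z → Any (λ g → EVDominates G g z) (others e)
    others-dominating z = let x , sx , xz = dom z in near-covered⇒dominated sx xz

  ¬both-shared : ∀ {e c l} → e ∈ D → Incident G e c → Incident G e l → c ≢ l →
                 Shared e c → ¬ Shared e l
  ¬both-shared {e} e∈ ic il c≢l sc sl = ¬othersDominate e∈ λ z →
    anchor z , all-shared (anchor-covered z) , anchor-near z
    where
    all-shared : ∀ {x} → Covered x → Shared e x
    all-shared cx with covered⇒shared⊎incident {e} cx
    ... | inj₁ sx = sx
    ... | inj₂ ix with incident-other ic il c≢l ix
    ...   | inj₁ refl = sc
    ...   | inj₂ refl = sl

  private-neighbour : ∀ {e c l} → e ∈ D → Incident G e c → Incident G e l → c ≢ l →
                      Shared e c → ¬ ¬ ∃ (Private l)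
  private-neighbour {e} {c} {l} e∈ ic il c≢l sc no-private = ¬othersDominate e∈ dom
    where
    shared⊎l : ∀ {x} → Covered x → Shared e x ⊎ x ≡ l
    shared⊎l cx with covered⇒shared⊎incident {e} cx
    ... | inj₁ sx = inj₁ sx
    ... | inj₂ ix with incident-other ic il c≢l ix
    ...   | inj₁ refl = inj₁ sc
    ...   | inj₂ x≡l  = inj₂ x≡l
    dom : OthersDominate e
    dom z with shared⊎l (anchor-covered z)
    ... | inj₁ s = anchor z , s , anchor-near z
    ... | inj₂ anchor≡l with covered? z
    ...   | no z∉ = ⊥-elim (no-private (z , z∉ , anchor≡l))
    ...   | yes cz with shared⊎l cz
    ...     | inj₁ s    = z , s , inj₁ refl
    ...     | inj₂ refl = c , sc , inj₂ (isEdge⇒adjacent (All.lookup D-edges e∈) ic il c≢l)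

  module Matching (owner : V → P)
                  (owner-spec : ∀ {x} → Covered x → owner x ∈ D × Incident G (owner x) x) where

    Displaced : P → V → Set
    Displaced e c = Shared e c × owner c ≢ e

    displaced? : ∀ e c → Dec (Displaced e c)
    displaced? e c = shared? e c ×-dec ¬? (owner c ≟ₚ e)

    ¬displaced⇒owned : ∀ {e x} → ¬ Displaced e x → Shared e x → owner x ≡ e
    ¬displaced⇒owned {e} {x} ¬dx sx = decidable-stable (owner x ≟ₚ e) λ ne → ¬dx (sx , ne)

    relocate : P → V → P
    relocate e l with private? l
    ... | yes (p , _) = orient l p
    ... | no  _       = e

    image : P → P
    image (a , b) with displaced? (a , b) a | displaced? (a , b) b
    ... | yes _ | _     = relocate (a , b) b
    ... | no  _ | yes _ = relocate (a , b) a
    ... | no  _ | no  _ = a , b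

    data Fate (e : P) : P → Set where
      kept  : (∀ {x} → Incident G e x → Shared e x → owner x ≡ e) → Fate e e
      moved : ∀ {c l p} → Incident G e c → Incident G e l → c ≢ l → Displaced e c →
              ¬ Shared e l → Private l p → Fate e (orient l p)

    relocate-fate : ∀ {e c l} → e ∈ D → Incident G e c → Incident G e l → c ≢ l →
                    Displaced e c → Fate e (relocate e l)
    relocate-fate {l = l} e∈ ic il c≢l dc with private? l
    ... | yes (_ , lp) = moved ic il c≢l dc (¬both-shared e∈ ic il c≢l (proj₁ dc)) lp
    ... | no  none     = ⊥-elim (private-neighbour e∈ ic il c≢l (proj₁ dc) none)

    fate : ∀ {e} → e ∈ D → Fate e (image e)
    fate {a , b} e∈ with displaced? (a , b) a | displaced? (a , b) b
    ... | yes da | _      = relocate-fate e∈ (inj₁ refl) (inj₂ refl) (D-ends-≢ e∈) da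
    ... | no  _  | yes db = relocate-fate e∈ (inj₂ refl) (inj₁ refl) (D-ends-≢ e∈ ∘ ≡.sym) db
    ... | no  na | no  nb = kept λ { (inj₁ refl) → ¬displaced⇒owned na
                                  ; (inj₂ refl) → ¬displaced⇒owned nb }

    fate-isEdge : ∀ {e e'} → e ∈ D → Fate e e' → IsEdge G e'
    fate-isEdge e∈ (kept _)              = All.lookup D-edges e∈
    fate-isEdge e∈ (moved _ il _ _ _ lp) =
      orient-isEdge (covered-private-≢ (lose e∈ il) lp) (private-adjacent lp)

    fate-covers : ∀ {e e' y} → Fate e e' → Incident G e y → Incident G e' y ⊎ Displaced e y
    fate-covers (kept _) iy = inj₁ iy
    fate-covers (moved {l = l} {p} ic il c≢l dc _ _) iy with incident-other ic il c≢l iy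
    ... | inj₁ refl = inj₂ dc
    ... | inj₂ refl = inj₁ (orient-incidentˡ l p)

    Owned : P → V → Set
    Owned e x = Incident G e x × (Shared e x → owner x ≡ e)

    Reached : P → V → Set
    Reached e x = ¬ Covered x × Incident G e (anchor x) × ¬ Shared e (anchor x)

    fate-incident : ∀ {e e' x} → Fate e e' → Incident G e' x → Owned e x ⊎ Reached e x
    fate-incident (kept own) ix = inj₁ (ix , own ix)
    fate-incident (moved {p = p} _ il _ _ nsl (p∉ , refl)) ix with orient-incident (anchor p) p ix
    ... | inj₁ refl = inj₁ (il , ⊥-elim ∘ nsl)
    ... | inj₂ refl = inj₂ (p∉ , il , nsl)

    fate-owned : ∀ {e e' x} → Fate e e' → Incident G e x → Shared e x → owner x ≡ e → e' ≡ e
    fate-owned (kept _) _ _ _ = refl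
    fate-owned (moved ic il c≢l (_ , c-not-owned) nsl _) ix sx owned with incident-other ic il c≢l ix
    ... | inj₁ refl = ⊥-elim (c-not-owned owned)
    ... | inj₂ refl = ⊥-elim (nsl sx)

    fate-displaced : ∀ {e e' x} → Fate e e' → Incident G e x → Displaced e x →
                     ∃₂ λ l p → Incident G e l × ¬ Shared e l × Private l p × Incident G e' p
    fate-displaced (kept own) ix (sx , not-owned) = ⊥-elim (not-owned (own ix sx))
    fate-displaced (moved {l = l} {p} _ il _ _ nsl lp) _ _ = l , p , il , nsl , lp , orient-incidentʳ l p

    M : List P
    M = map image D

    covers : ∀ {y} → Covered y → InVG G M y
    covers cy with owner-spec cy
    ... | o∈ , io with fate-covers (fate o∈) io
    ...   | inj₁ i                = lose (∈-map⁺ image o∈) i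
    ...   | inj₂ (_ , not-owned) = ⊥-elim (not-owned refl)

    images-disjoint : ∀ {d₁ d₂} → d₁ ∈ D → d₂ ∈ D → d₁ ≢ d₂ →
                      ¬ ShareVertex G (image d₁) (image d₂)
    images-disjoint {d₁} {d₂} d₁∈ d₂∈ d₁≢d₂ (x , i₁ , i₂) =
      both (fate-incident (fate d₁∈) i₁) (fate-incident (fate d₂∈) i₂)
      where
      d₂≢d₁ : d₂ ≢ d₁
      d₂≢d₁ = d₁≢d₂ ∘ ≡.sym
      both : Owned d₁ x ⊎ Reached d₁ x → Owned d₂ x ⊎ Reached d₂ x → ⊥
      both (inj₁ (j₁ , own₁)) (inj₁ (j₂ , own₂)) =
        d₁≢d₂ (trans (≡.sym (own₁ (shared-by d₂∈ d₂≢d₁ j₂))) (own₂ (shared-by d₁∈ d₁≢d₂ j₁)))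
      both (inj₁ (j₁ , _)) (inj₂ (x∉ , _)) = x∉ (lose d₁∈ j₁)
      both (inj₂ (x∉ , _)) (inj₁ (j₂ , _)) = x∉ (lose d₂∈ j₂)
      both (inj₂ (_ , _ , nsa₁)) (inj₂ (_ , ia₂ , _)) = nsa₁ (shared-by d₂∈ d₂≢d₁ ia₂)

    M-matching : NoTwoShare G M
    M-matching _ _ e∈ f∈ e≢f with ∈-map⁻ image e∈ | ∈-map⁻ image f∈
    ... | _ , d₁∈ , refl | _ , d₂∈ , refl = images-disjoint d₁∈ d₂∈ λ { refl → e≢f refl }

    M-minimum : IsMinEVDS G M
    M-minimum = ((edges , unique) , dominating) , λ M' M'-evds →
      subst (_≤ length M') (≡.sym (length-map image D)) (proj₂ D-min M' M'-evds)
      where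
      edges : All (IsEdge G) M
      edges = All.map⁺ (All.tabulate λ d∈ → fate-isEdge d∈ (fate d∈))
      unique : Unique M
      unique = unique-map⁺ image (λ d₁∈ d₂∈ → disjoint⇒≢ ∘ images-disjoint d₁∈ d₂∈) D-unique
      dominating : ∀ z → Any (λ e → EVDominates G e z) M
      dominating z = near-covered⇒dominated (covers (anchor-covered z)) (anchor-near z)

    displaced-private : ∀ {e x} → e ∈ D → Incident G e x → Displaced e x →
                        ∃₂ λ l p → Incident G e l × ¬ Shared e l × Private l p × InVG G M p
    displaced-private e∈ ix dx with fate-displaced (fate e∈) ix dx
    ... | l , p , il , nsl , lp , ip = l , p , il , nsl , lp , lose (∈-map⁺ image e∈) ip

    private-uncovered : ∀ {e x l p} → e ∈ D → Incident G e x → Shared e x → owner x ≡ e →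
                        Incident G e l → ¬ Shared e l → Private l p → ¬ InVG G M p
    private-uncovered {e} {p = p} e∈ ix sx owned il nsl (p∉ , refl) ip with find ip
    ... | _ , g∈ , ig with ∈-map⁻ image g∈
    ...   | d , d∈ , refl with fate-incident (fate d∈) ig
    ...     | inj₁ (jd , _) = p∉ (lose d∈ jd)
    ...     | inj₂ (_ , _ , nsd) with d ≟ₚ e
    ...       | yes refl = p∉ (lose e∈ (subst (λ e' → Incident G e' p) (fate-owned (fate e∈) ix sx owned) ig))
    ...       | no  d≢e  = nsd (shared-by e∈ (d≢e ∘ ≡.sym) il)

  -- The owner of an uncovered vertex is junk.
  ownerAt : V → P → V → P
  ownerAt c e x with x Fin.≟ c
  ... | yes _ = e
  ... | no  _ with covered? x
  ...   | yes cx = proj₁ (find cx)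
  ...   | no  _  = e

  ownerAt-spec : ∀ {c e} → e ∈ D → Incident G e c →
                 ∀ {x} → Covered x → ownerAt c e x ∈ D × Incident G (ownerAt c e x) x
  ownerAt-spec {c} e∈ ic {x} cx with x Fin.≟ c
  ... | yes refl = e∈ , ic
  ... | no  _ with covered? x
  ...   | yes cx' = proj₂ (find cx')
  ...   | no  x∉  = ⊥-elim (x∉ cx)

  ownerAt-self : ∀ c e → ownerAt c e c ≡ e
  ownerAt-self c e with c Fin.≟ c
  ... | yes _   = refl
  ... | no  c≢c = ⊥-elim (c≢c refl)

lemma3 : (G : Graph) (D : List (Pair G)) → IsMinEVDS G D → HasAdjacentEdges G D →
         ∃ λ D' → ∃ λ D'' → IsMinEVDS G D' × IsMinEVDS G D'' ×
           ¬ SameEdgeSet G D' D'' × ¬ SameVertexSet G D' D'' ×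
           NoTwoShare G D' × NoTwoShare G D''
lemma3 G D D-min (e₁ , e₂ , e₁∈ , e₂∈ , e₁≢e₂ , v , i₁ , i₂) =
  A.M , B.M , A.M-minimum , B.M-minimum ,
  vertexSets-differ ∘ sameEdgeSet⇒sameVertexSet , vertexSets-differ ,
  A.M-matching , B.M-matching
  where
  open Minimum G D D-min
  module A = Matching (ownerAt v e₁) (ownerAt-spec e₁∈ i₁)
  module B = Matching (ownerAt v e₂) (ownerAt-spec e₂∈ i₂)

  v-shared : Shared e₂ v
  v-shared = shared-by e₁∈ e₁≢e₂ i₁

  vertexSets-differ : ¬ SameVertexSet G A.M B.M
  vertexSets-differ same
    with A.displaced-private e₂∈ i₂ (v-shared , λ owned → e₁≢e₂ (trans (≡.sym (ownerAt-self v e₁)) owned))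
  ... | _ , p , il , nsl , lp , p∈A =
    B.private-uncovered e₂∈ i₂ v-shared (ownerAt-self v e₂) il nsl lp (Equivalence.to (same p) p∈A)
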